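{- Let $(S,\star)$ and $(T,\diamond)$ be involution semigroups and let $(T,\diamond)$ have an involutory action on $(S,\star)$. Then the bilateral semidirect product $S\ltimes T$ equipped with the map $\dagger:(s,t)\mapsto(s^\star,t^\diamond)$ is an involution semigroup.
   Context: Involution semigroups satisfy $(a^\star)^\star=a$, $(ab)^\star=b^\star a^\star$. Write $S$ additively (not necessarily commutative). A left action of $T$ on $S$, $(t,s)\mapsto ts$, satisfies $t(s+s')=ts+ts'$ and $(tt')s=t(t's)$; a right action $(s,t)\mapsto st$ satisfies $(s+s')t=st+s't$, $s(tt')=(st)t'$; they are compatible if $(ts)t'=t(st')$; the pair is an involutory action if moreover $(st)^\star=t^\diamond s^\star$. The bilateral semidirect product $S\ltimes T$ is $S\times T$ with product $(s_1,t_1)(s_2,t_2)=(s_1t_2+t_1s_2,\,t_1t_2)$. -}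

module Defs where

open import Level using (Level; _⊔_; suc)
open import Relation.Binary.PropositionalEquality using (_≡_)
open import Algebra.Core using (Op₂; Op₁)
open import Algebra.Structures using (IsSemigroup)
open import Data.Product using (_×_; _,_)

record InvolutionSemigroup (a : Level) : Set (suc a) where
  field
    Carrier     : Set a
    _∙_         : Op₂ Carrier
    _⋆          : Op₁ Carrier
    isSemigroup : IsSemigroup _≡_ _∙_
    ⋆-involutive : ∀ x → (x ⋆) ⋆ ≡ x
    ⋆-anti       : ∀ x y → (x ∙ y) ⋆ ≡ (y ⋆) ∙ (x ⋆)

module _ {a b : Level} (S : InvolutionSemigroup a) (T : InvolutionSemigroup b) where
  private
    module S = InvolutionSemigroup S
    module T = InvolutionSemigroup T

  record InvolutoryAction : Set (a ⊔ b) where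
    field
      _▹_ : T.Carrier → S.Carrier → S.Carrier
      _◃_ : S.Carrier → T.Carrier → S.Carrier
      ▹-distrib : ∀ t s s′ → t ▹ (s S.∙ s′) ≡ (t ▹ s) S.∙ (t ▹ s′)
      ▹-assoc   : ∀ t t′ s → (t T.∙ t′) ▹ s ≡ t ▹ (t′ ▹ s)
      ◃-distrib : ∀ s s′ t → (s S.∙ s′) ◃ t ≡ (s ◃ t) S.∙ (s′ ◃ t)
      ◃-assoc   : ∀ s t t′ → s ◃ (t T.∙ t′) ≡ (s ◃ t) ◃ t′
      compatible : ∀ t s t′ → (t ▹ s) ◃ t′ ≡ t ▹ (s ◃ t′)
      involutory : ∀ s t → (s ◃ t) S.⋆ ≡ (t T.⋆) ▹ (s S.⋆)

  module _ (act : InvolutoryAction) where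
    open InvolutoryAction act

    ⋉-Carrier : Set (a ⊔ b)
    ⋉-Carrier = S.Carrier × T.Carrier

    _⋉∙_ : Op₂ ⋉-Carrier
    (s₁ , t₁) ⋉∙ (s₂ , t₂) = ((s₁ ◃ t₂) S.∙ (t₁ ▹ s₂)) , (t₁ T.∙ t₂)

    † : Op₁ ⋉-Carrier
    † (s , t) = (s S.⋆) , (t T.⋆)

    IsInvolutionSemigroup⋉ : Set (a ⊔ b)
    IsInvolutionSemigroup⋉ =
      IsSemigroup _≡_ _⋉∙_ × ((∀ x → † († x) ≡ x) × (∀ x y → † (x ⋉∙ y) ≡ † y ⋉∙ † x))

{-# OPTIONS --safe #-}
module Submission where

open import Level using (Level)
open import Data.Product using (_,_)
open import Relation.Binary.PropositionalEquality
open import Algebra.Structures using (IsSemigroup)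
open import Defs

module _ {a b : Level} {S : InvolutionSemigroup a} {T : InvolutionSemigroup b}
         (act : InvolutoryAction S T) where
  private
    module S = InvolutionSemigroup S
    module T = InvolutionSemigroup T
  open InvolutoryAction act
  open ≡-Reasoning

  private
    _·_ = _⋉∙_ S T act

  ⋉-assoc : ∀ x y z → (x · y) · z ≡ x · (y · z)
  ⋉-assoc (s₁ , t₁) (s₂ , t₂) (s₃ , t₃) = cong₂ _,_ first (IsSemigroup.assoc T.isSemigroup t₁ t₂ t₃)
    where
    first : (((s₁ ◃ t₂) S.∙ (t₁ ▹ s₂)) ◃ t₃) S.∙ ((t₁ T.∙ t₂) ▹ s₃)
          ≡ (s₁ ◃ (t₂ T.∙ t₃)) S.∙ (t₁ ▹ ((s₂ ◃ t₃) S.∙ (t₂ ▹ s₃)))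
    first = begin
      (((s₁ ◃ t₂) S.∙ (t₁ ▹ s₂)) ◃ t₃) S.∙ ((t₁ T.∙ t₂) ▹ s₃)
        ≡⟨ cong₂ S._∙_ (◃-distrib _ _ t₃) (▹-assoc t₁ t₂ s₃) ⟩
      (((s₁ ◃ t₂) ◃ t₃) S.∙ ((t₁ ▹ s₂) ◃ t₃)) S.∙ (t₁ ▹ (t₂ ▹ s₃))
        ≡⟨ IsSemigroup.assoc S.isSemigroup _ _ _ ⟩
      ((s₁ ◃ t₂) ◃ t₃) S.∙ (((t₁ ▹ s₂) ◃ t₃) S.∙ (t₁ ▹ (t₂ ▹ s₃)))
        ≡⟨ cong₂ S._∙_ (sym (◃-assoc s₁ t₂ t₃)) (cong (S._∙ (t₁ ▹ (t₂ ▹ s₃))) (compatible t₁ s₂ t₃)) ⟩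
      (s₁ ◃ (t₂ T.∙ t₃)) S.∙ ((t₁ ▹ (s₂ ◃ t₃)) S.∙ (t₁ ▹ (t₂ ▹ s₃)))
        ≡⟨ cong ((s₁ ◃ (t₂ T.∙ t₃)) S.∙_) (sym (▹-distrib t₁ _ _)) ⟩
      (s₁ ◃ (t₂ T.∙ t₃)) S.∙ (t₁ ▹ ((s₂ ◃ t₃) S.∙ (t₂ ▹ s₃)))
        ∎

  ⋉-isSemigroup : IsSemigroup _≡_ _·_
  ⋉-isSemigroup = record
    { isMagma = record { isEquivalence = isEquivalence ; ∙-cong = cong₂ _·_ }
    ; assoc   = ⋉-assoc
    }

  †-involutive : ∀ x → † S T act († S T act x) ≡ x
  †-involutive (s , t) = cong₂ _,_ (S.⋆-involutive s) (T.⋆-involutive t)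

  -- The involutory law for the left action, obtained by applying the given one to s⋆ and t⋆.
  ▹-involutory : ∀ t s → (t ▹ s) S.⋆ ≡ (s S.⋆) ◃ (t T.⋆)
  ▹-involutory t s = begin
    (t ▹ s) S.⋆
      ≡⟨ cong S._⋆ (sym (cong₂ _▹_ (T.⋆-involutive t) (S.⋆-involutive s))) ⟩
    (((t T.⋆) T.⋆) ▹ ((s S.⋆) S.⋆)) S.⋆
      ≡⟨ cong S._⋆ (sym (involutory (s S.⋆) (t T.⋆))) ⟩
    (((s S.⋆) ◃ (t T.⋆)) S.⋆) S.⋆
      ≡⟨ S.⋆-involutive _ ⟩
    (s S.⋆) ◃ (t T.⋆)
      ∎

  †-anti : ∀ x y → † S T act (x · y) ≡ † S T act y · † S T act x
  †-anti (s₁ , t₁) (s₂ , t₂) = cong₂ _,_ first (T.⋆-anti t₁ t₂)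
    where
    first : ((s₁ ◃ t₂) S.∙ (t₁ ▹ s₂)) S.⋆ ≡ ((s₂ S.⋆) ◃ (t₁ T.⋆)) S.∙ ((t₂ T.⋆) ▹ (s₁ S.⋆))
    first = begin
      ((s₁ ◃ t₂) S.∙ (t₁ ▹ s₂)) S.⋆
        ≡⟨ S.⋆-anti _ _ ⟩
      ((t₁ ▹ s₂) S.⋆) S.∙ ((s₁ ◃ t₂) S.⋆)
        ≡⟨ cong₂ S._∙_ (▹-involutory t₁ s₂) (involutory s₁ t₂) ⟩
      ((s₂ S.⋆) ◃ (t₁ T.⋆)) S.∙ ((t₂ T.⋆) ▹ (s₁ S.⋆))
        ∎

lemma4 : {a b : Level} (S : InvolutionSemigroup a) (T : InvolutionSemigroup b)
         (act : InvolutoryAction S T) → IsInvolutionSemigroup⋉ S T act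
lemma4 S T act = ⋉-isSemigroup act , †-involutive act , †-anti act
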